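{- Let $p$ be an odd prime and let $\mathscr{L}=\mathscr{L}_p=\mathcal{L}(GA_{2p},(-1,2))$. Then for $(x,z),(y,w)\in\mathbb{Z}_p\times\{1,2\}$ with $(x,z),(y,w)\neq(-1,2)$, \[ \mathscr{L}_{(x,z),(y,w)}=\begin{cases} (x,z) & \text{if } (x,z)=(y,w),\\ (x+y+1,2) & \text{if } z=w \text{ and } x+y+2\neq 0,\\ (-1,1) & \text{if } z=w \text{ and } x+y+2=0,\\ (2x+1,2) & \text{if } z\neq w \text{ and } x=y,\\ (x-y-1,1) & \text{if } z=1,\ w=2 \text{ and } x\neq y,\\ (y-x-1,1) & \text{if } z=2,\ w=1 \text{ and } x\neq y. \end{cases} \]
   Context: Let $p$ be an odd prime and let $K_{2p}$ have vertex set $\mathbb{Z}_p\times\{1,2\}$. For $i\in\mathbb{Z}_p$ let $f_i=\{(i+j,1)(i-j,1),\,(i+j,2)(i-j,2) : j\in\{1,\dots,(p-1)/2\}\}\cup\{(i,1)(i,2)\}$, and for $i\in\mathbb{Z}_p\setminus\{0\}$ let $g_i=\{(j,1)(i+j,2): j\in\mathbb{Z}_p\}$. Then $GA_{2p}=\{f_i: i\in\mathbb{Z}_p\}\cup\{g_i: i\in\mathbb{Z}_p\setminus\{0\}\}$ is a $1$-factorisation of $K_{2p}$ (a partition of the edges into perfect matchings). For a $1$-factorisation $\mathcal{F}$ of a complete graph $K_{n+1}$ with vertex set $V$ ($n$ odd), and distinct $x,y\in V$, let $h_{x,y}$ be the unique $1$-factor of $\mathcal{F}$ containing edge $xy$.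 For a root vertex $v\in V$, $\mathcal{L}(\mathcal{F},v)$ is the Latin square with row, column and symbol set $V\setminus\{v\}$ defined by $\mathcal{L}(\mathcal{F},v)_{i,i}=i$ and, for $j\neq i$, $\mathcal{L}(\mathcal{F},v)_{i,j}=k$ where $k\in V\setminus\{v\}$ is such that $kv\in h_{i,j}$. -}

module Defs where

open import Data.Nat using (ℕ; zero; suc; _∸_; _≤_; NonZero)
open import Data.Nat.DivMod using (_mod_)
open import Data.Fin using (Fin; toℕ)
open import Data.Product using (_×_; _,_; Σ; ∃)
open import Data.Sum using (_⊎_)
open import Relation.Binary.PropositionalEquality using (_≡_; _≢_)
import Data.Nat as N

data Side : Set where
  one two : Side

module _ (p : ℕ) .{{_ : NonZero p}} where

  Zp : Set
  Zp = Fin p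

  [_] : ℕ → Zp
  [ k ] = k mod p

  _⊕_ : Zp → Zp → Zp
  a ⊕ b = (toℕ a N.+ toℕ b) mod p

  ⊖_ : Zp → Zp
  ⊖ a = (p ∸ toℕ a) mod p

  _⊝_ : Zp → Zp → Zp
  a ⊝ b = a ⊕ (⊖ b)

  Vertex : Set
  Vertex = Zp × Side

  -- names of the 1-factors of GA_{2p}: f_i (i ∈ ℤ_p) and g_i (i ∈ ℤ_p ∖ {0})
  data Factor : Set where
    f : Zp → Factor
    g : (i : Zp) → i ≢ [ 0 ] → Factor

  InF' : Factor → Vertex → Vertex → Set
  InF' (f i) a b =
      (Σ ℕ λ j → 1 ≤ j × j ≤ (p ∸ 1) N./ 2 ×
         ((a ≡ (i ⊕ [ j ] , one) × b ≡ (i ⊝ [ j ] , one))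
        ⊎ (a ≡ (i ⊕ [ j ] , two) × b ≡ (i ⊝ [ j ] , two))))
    ⊎ (a ≡ (i , one) × b ≡ (i , two))
  InF' (g i _) a b = Σ Zp λ j → a ≡ (j , one) × b ≡ (i ⊕ j , two)

  InF : Factor → Vertex → Vertex → Set
  InF F a b = InF' F a b ⊎ InF' F b a

  -- Graph of the Latin square L(GA_{2p}, v):  LRel v i j k  means
  -- L_{i,j} = k, i.e. k = i when i = j, and otherwise kv lies in the
  -- (unique) 1-factor of GA_{2p} that contains the edge ij.
  LRel : Vertex → Vertex → Vertex → Vertex → Set
  LRel v i j k = (i ≡ j × k ≡ i) ⊎ (i ≢ j × ∃ λ F → InF F i j × InF F k v)

  LIs : Vertex → Vertex → Vertex → Vertex → Set
  LIs v i j val = val ≢ v × LRel v i j val × (∀ k → k ≢ v → LRel v i j k → k ≡ val)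

-- An edge of f_i inside a layer joins x and y with x + y = 2i, the only edge of
-- f_i between the layers is (i,1)(i,2), and g_i joins (x,1) to (x+i,2).  So the
-- factor through a pair of cells is read off from it (for two cells in one layer
-- it is f_i with i the midpoint, which exists and is unique because p is odd),
-- and the entry is the partner of the root (−1,2) in that factor, found by the
-- same three rules.

module Submission where

open import Defs
open import Data.Nat as ℕ using (ℕ; NonZero; suc; _∸_; _≤_; _<_; _%_; _/_; _≤?_)
import Data.Nat.Properties as ℕ
open import Data.Nat.DivMod using (m≡m%n+[m/n]*n; m%n<n; m<n⇒m%n≡m; m*n/n≡m)
import Data.Nat.Divisibility as ℕ
open import Data.Nat.Primality using (Prime; prime⇒irreducible)
open import Data.Fin using (toℕ)
open import Data.Fin.Properties using (toℕ-injective; toℕ-fromℕ<; toℕ<n)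
open import Data.Integer using (ℤ; +_; 1ℤ; 0ℤ; _+_; _*_; _-_; -_; ∣_∣; _⊖_)
open import Data.Integer.Properties using (pos-+; pos-*; +-injective; ∣i∣≡0⇒i≡0;
  i-j≡0⇒i≡j; [+m]-[+n]≡m⊖n; ∣m⊝n∣≤m⊔n; ⊖-≥; +-minus-telescope; +-comm; +-identityˡ; +-identityʳ)
open import Data.Integer.Divisibility.Signed using (_∣_; divides; ∣⇒∣ᵤ; ∣m∣n⇒∣m+n; ∣m⇒∣-m; ∣n⇒∣m*n)
open import Data.Integer.Tactic.RingSolver using (solve-∀)
open import Data.Product using (_×_; _,_; Σ; ∃; proj₁; proj₂)
open import Data.Sum using (_⊎_; inj₁; inj₂; swap; [_,_]′)
open import Data.Empty using (⊥-elim)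
open import Function using (_∘_)
open import Relation.Nullary using (¬_; yes; no)
open import Relation.Binary.PropositionalEquality hiding ([_])

module ZpArithmetic (p : ℕ) .{{_ : NonZero p}} where

  infixl 6 _+ₚ_ _-ₚ_
  infix 8 -ₚ_

  _+ₚ_ : Zp p → Zp p → Zp p
  _+ₚ_ = _⊕_ p

  -ₚ_ : Zp p → Zp p
  -ₚ_ = ⊖_ p

  _-ₚ_ : Zp p → Zp p → Zp p
  _-ₚ_ = _⊝_ p

  [_]ₚ : ℕ → Zp p
  [_]ₚ = [_] p

  toℤ : Zp p → ℤ
  toℤ a = + toℕ a

  infix 4 _≈_
  record _≈_ (u w : ℤ) : Set where
    constructor ≈-intro
    field p∣u-w : + p ∣ u - w

  ≈-by-multiple : ∀ {u w} k → u ≡ w + k * + p → u ≈ w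
  ≈-by-multiple {u} {w} k u≡w+kp = ≈-intro (divides k (begin
    u - w               ≡⟨ cong (_- w) u≡w+kp ⟩
    w + k * + p - w     ≡⟨ cancel w (k * + p) ⟩
    k * + p             ∎))
    where
    open ≡-Reasoning
    cancel : ∀ w x → w + x - w ≡ x
    cancel = solve-∀

  ≈-reflexive : ∀ {u w} → u ≡ w → u ≈ w
  ≈-reflexive {u} refl = ≈-by-multiple 0ℤ (sym (+-identityʳ u))

  ≈-sym : ∀ {u w} → u ≈ w → w ≈ u
  ≈-sym {u} {w} (≈-intro p∣u-w) = ≈-intro (subst (+ p ∣_) (swap-minus u w) (∣m⇒∣-m p∣u-w))
    where
    swap-minus : ∀ u w → - (u - w) ≡ w - u
    swap-minus = solve-∀

  ≈-trans : ∀ {u w t} → u ≈ w → w ≈ t → u ≈ t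
  ≈-trans {u} {w} {t} (≈-intro p∣u-w) (≈-intro p∣w-t) =
    ≈-intro (subst (+ p ∣_) (+-minus-telescope u w t) (∣m∣n⇒∣m+n p∣u-w p∣w-t))

  +-cong : ∀ {u u′ w w′} → u ≈ w → u′ ≈ w′ → u + u′ ≈ w + w′
  +-cong {u} {u′} {w} {w′} (≈-intro p∣u-w) (≈-intro p∣u′-w′) =
    ≈-intro (subst (+ p ∣_) (regroup u u′ w w′) (∣m∣n⇒∣m+n p∣u-w p∣u′-w′))
    where
    regroup : ∀ u u′ w w′ → (u - w) + (u′ - w′) ≡ (u + u′) - (w + w′)
    regroup = solve-∀

  neg-cong : ∀ {u w} → u ≈ w → - u ≈ - w
  neg-cong {u} {w} (≈-intro p∣u-w) = ≈-intro (subst (+ p ∣_) (regroup u w) (∣m⇒∣-m p∣u-w))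
    where
    regroup : ∀ u w → - (u - w) ≡ - u - - w
    regroup = solve-∀

  *-congˡ : ∀ k {u w} → u ≈ w → k * u ≈ k * w
  *-congˡ k {u} {w} (≈-intro p∣u-w) = ≈-intro (subst (+ p ∣_) (distrib k u w) (∣n⇒∣m*n k p∣u-w))
    where
    distrib : ∀ k u w → k * (u - w) ≡ k * u - k * w
    distrib = solve-∀

  toℤ-[] : ∀ m → toℤ [ m ]ₚ ≈ + m
  toℤ-[] m = ≈-sym (≈-by-multiple (+ (m / p)) (begin
    + m                           ≡⟨ cong +_ (m≡m%n+[m/n]*n m p) ⟩
    + (m % p ℕ.+ m / p ℕ.* p)     ≡⟨ pos-+ (m % p) (m / p ℕ.* p) ⟩
    + (m % p) + + (m / p ℕ.* p)   ≡⟨ cong₂ _+_ (cong +_ (sym (toℕ-fromℕ< (m%n<n m p)))) (pos-* (m / p) p) ⟩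
    toℤ [ m ]ₚ + + (m / p) * + p  ∎))
    where open ≡-Reasoning

  toℤ-+ₚ : ∀ a b → toℤ (a +ₚ b) ≈ toℤ a + toℤ b
  toℤ-+ₚ a b = ≈-trans (toℤ-[] (toℕ a ℕ.+ toℕ b)) (≈-reflexive (pos-+ (toℕ a) (toℕ b)))

  toℤ-neg : ∀ a → toℤ (-ₚ a) ≈ - toℤ a
  toℤ-neg a = ≈-trans (toℤ-[] (p ∸ toℕ a)) (≈-by-multiple 1ℤ (begin
    + (p ∸ toℕ a)        ≡⟨ ⊖-≥ (ℕ.<⇒≤ (toℕ<n a)) ⟨
    p ⊖ toℕ a            ≡⟨ [+m]-[+n]≡m⊖n p (toℕ a) ⟨
    + p - toℤ a          ≡⟨ reorder (+ p) (toℤ a) ⟩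
    - toℤ a + 1ℤ * + p   ∎))
    where
    open ≡-Reasoning
    reorder : ∀ P A → P - A ≡ - A + 1ℤ * P
    reorder = solve-∀

  toℤ-injective : ∀ {a b} → toℤ a ≈ toℤ b → a ≡ b
  toℤ-injective {a} {b} (≈-intro p∣a-b) =
    toℕ-injective (+-injective (i-j≡0⇒i≡j _ _ (∣i∣≡0⇒i≡0 ∣a-b∣≡0)))
    where
    ∣a-b∣<p : ∣ toℤ a - toℤ b ∣ < p
    ∣a-b∣<p = begin-strict
      ∣ toℤ a - toℤ b ∣      ≡⟨ cong ∣_∣ ([+m]-[+n]≡m⊖n (toℕ a) (toℕ b)) ⟩
      ∣ toℕ a ⊖ toℕ b ∣      ≤⟨ ∣m⊝n∣≤m⊔n (toℕ a) (toℕ b) ⟩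
      toℕ a ℕ.⊔ toℕ b        <⟨ ℕ.⊔-lub (toℕ<n a) (toℕ<n b) ⟩
      p                      ∎
      where open ℕ.≤-Reasoning
    ∣a-b∣≡0 : ∣ toℤ a - toℤ b ∣ ≡ 0
    ∣a-b∣≡0 = trans (sym (m<n⇒m%n≡m ∣a-b∣<p)) (ℕ.n∣m⇒m%n≡0 _ p (∣⇒∣ᵤ p∣a-b))

  -- Equations in ℤ_p are proved by reading both sides as integer expressions,
  -- where the ring solver closes them; toℤ is a ring homomorphism modulo p.
  infixl 6 _:+_ _:-_
  infix 8 :-_

  data Expr : Set where
    atom : Zp p → Expr
    lit  : ℕ → Expr
    _:+_ : Expr → Expr → Expr
    :-_  : Expr → Expr

  _:-_ : Expr → Expr → Expr
  e :- e′ = e :+ :- e′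

  ⟦_⟧ : Expr → Zp p
  ⟦ atom a ⟧   = a
  ⟦ lit n ⟧    = [ n ]ₚ
  ⟦ e :+ e′ ⟧  = ⟦ e ⟧ +ₚ ⟦ e′ ⟧
  ⟦ :- e ⟧     = -ₚ ⟦ e ⟧

  ⟦_⟧ℤ : Expr → ℤ
  ⟦ atom a ⟧ℤ  = toℤ a
  ⟦ lit n ⟧ℤ   = + n
  ⟦ e :+ e′ ⟧ℤ = ⟦ e ⟧ℤ + ⟦ e′ ⟧ℤ
  ⟦ :- e ⟧ℤ    = - ⟦ e ⟧ℤ

  ⟦⟧-sound : ∀ e → toℤ ⟦ e ⟧ ≈ ⟦ e ⟧ℤ
  ⟦⟧-sound (atom a)  = ≈-reflexive refl
  ⟦⟧-sound (lit n)   = toℤ-[] n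
  ⟦⟧-sound (e :+ e′) = ≈-trans (toℤ-+ₚ ⟦ e ⟧ ⟦ e′ ⟧) (+-cong (⟦⟧-sound e) (⟦⟧-sound e′))
  ⟦⟧-sound (:- e)    = ≈-trans (toℤ-neg ⟦ e ⟧) (neg-cong (⟦⟧-sound e))

  ≡-byℤ : ∀ e e′ → ⟦ e ⟧ℤ ≡ ⟦ e′ ⟧ℤ → ⟦ e ⟧ ≡ ⟦ e′ ⟧
  ≡-byℤ e e′ eq =
    toℤ-injective (≈-trans (⟦⟧-sound e) (≈-trans (≈-reflexive eq) (≈-sym (⟦⟧-sound e′))))

  +ₚ-comm : ∀ a b → a +ₚ b ≡ b +ₚ a
  +ₚ-comm a b = ≡-byℤ (atom a :+ atom b) (atom b :+ atom a) (+-comm (toℤ a) (toℤ b))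

  [toℕ]ₚ : ∀ a → [ toℕ a ]ₚ ≡ a
  [toℕ]ₚ a = toℤ-injective (toℤ-[] (toℕ a))

  a+b-b≡a : ∀ a b → a +ₚ b -ₚ b ≡ a
  a+b-b≡a a b = ≡-byℤ (atom a :+ atom b :- atom b) (atom a) (identity (toℤ a) (toℤ b))
    where
    identity : ∀ a b → a + b - b ≡ a
    identity = solve-∀

  +ₚ-identityˡ : ∀ a → [ 0 ]ₚ +ₚ a ≡ a
  +ₚ-identityˡ a = ≡-byℤ (lit 0 :+ atom a) (atom a) (+-identityˡ (toℤ a))

  a+b≡c⇒a≡c-b : ∀ {a} b {c} → a +ₚ b ≡ c → a ≡ c -ₚ b
  a+b≡c⇒a≡c-b {a} b a+b≡c = trans (sym (a+b-b≡a a b)) (cong (_-ₚ b) a+b≡c)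

  +ₚ-cancelʳ : ∀ c {a b} → a +ₚ c ≡ b +ₚ c → a ≡ b
  +ₚ-cancelʳ c {b = b} a+c≡b+c = trans (a+b≡c⇒a≡c-b c a+c≡b+c) (a+b-b≡a b c)

module OddZp (p q : ℕ) .{{_ : NonZero p}} (p≡1+2q : p ≡ suc (2 ℕ.* q)) where

  open ZpArithmetic p

  -- (q + 1) is the inverse of 2 modulo p = 2q + 1.
  half : Zp p → Zp p
  half a = [ suc q ℕ.* toℕ a ]ₚ

  private
    p≡1+2q-ℤ : + p ≡ 1ℤ + + 2 * + q
    p≡1+2q-ℤ = trans (cong +_ p≡1+2q) (trans (pos-+ 1 (2 ℕ.* q)) (cong (λ n → 1ℤ + n) (pos-* 2 q)))

    toℤ-half : ∀ a → toℤ (half a) ≈ (1ℤ + + q) * toℤ a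
    toℤ-half a = ≈-trans (toℤ-[] (suc q ℕ.* toℕ a))
                         (≈-reflexive (trans (pos-* (suc q) (toℕ a)) (cong (_* toℤ a) (pos-+ 1 q))))

    twice-half : ∀ u → (1ℤ + + q) * (u + u) ≈ u
    twice-half u = ≈-by-multiple u (begin
      (1ℤ + + q) * (u + u)      ≡⟨ identity u (+ q) ⟩
      u + u * (1ℤ + + 2 * + q)  ≡⟨ cong (λ P → u + u * P) p≡1+2q-ℤ ⟨
      u + u * + p               ∎)
      where
      open ≡-Reasoning
      identity : ∀ u q → (1ℤ + q) * (u + u) ≡ u + u * (1ℤ + + 2 * q)
      identity = solve-∀

  half-+ₚ-half : ∀ a → half a +ₚ half a ≡ a
  half-+ₚ-half a = toℤ-injective (≈-trans (toℤ-+ₚ (half a) (half a)) (≈-trans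
    (+-cong (toℤ-half a) (toℤ-half a))
    (≈-trans (≈-reflexive (identity (+ q) (toℤ a))) (twice-half (toℤ a)))))
    where
    identity : ∀ q u → (1ℤ + q) * u + (1ℤ + q) * u ≡ (1ℤ + q) * (u + u)
    identity = solve-∀

  half-double : ∀ a → half (a +ₚ a) ≡ a
  half-double a = toℤ-injective (≈-trans (toℤ-half (a +ₚ a))
    (≈-trans (*-congˡ (1ℤ + + q) (toℤ-+ₚ a a)) (twice-half (toℤ a))))

  +ₚ-double-injective : ∀ {a b} → a +ₚ a ≡ b +ₚ b → a ≡ b
  +ₚ-double-injective {a} {b} 2a≡2b =
    trans (sym (half-double a)) (trans (cong half 2a≡2b) (half-double b))

  private
    ≤q⇒≤[p∸1]/2 : ∀ {j} → j ≤ q → j ≤ (p ∸ 1) / 2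
    ≤q⇒≤[p∸1]/2 = subst (_ ≤_) (sym (trans (cong (λ n → (n ∸ 1) / 2) p≡1+2q)
                                           (trans (cong (_/ 2) (ℕ.*-comm 2 q)) (m*n/n≡m q 2))))

    p∸[1+q]≡q : p ∸ suc q ≡ q
    p∸[1+q]≡q = trans (cong (_∸ suc q) p≡1+2q) (trans (ℕ.m+n∸m≡n q (q ℕ.+ 0)) (ℕ.+-identityʳ q))

  ±-representative : ∀ {d} → d ≢ [ 0 ]ₚ →
    Σ ℕ λ j → 1 ≤ j × j ≤ (p ∸ 1) / 2 × (d ≡ [ j ]ₚ ⊎ -ₚ d ≡ [ j ]ₚ)
  ±-representative {d} d≢0 with toℕ d ≤? q
  ... | yes d≤q = toℕ d , ℕ.n≢0⇒n>0 (d≢0 ∘ toℕ≡0⇒≡0) , ≤q⇒≤[p∸1]/2 d≤q , inj₁ (sym ([toℕ]ₚ d))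
    where
    toℕ≡0⇒≡0 : toℕ d ≡ 0 → d ≡ [ 0 ]ₚ
    toℕ≡0⇒≡0 d≡0 = trans (sym ([toℕ]ₚ d)) (cong [_]ₚ d≡0)
  ... | no d≰q = p ∸ toℕ d , ℕ.m<n⇒0<n∸m (toℕ<n d) , ≤q⇒≤[p∸1]/2 p∸d≤q , inj₂ refl
    where
    p∸d≤q : p ∸ toℕ d ≤ q
    p∸d≤q = subst (p ∸ toℕ d ≤_) p∸[1+q]≡q (ℕ.∸-monoʳ-≤ p (ℕ.≰⇒> d≰q))

module GA (p : ℕ) .{{_ : NonZero p}} where

  open ZpArithmetic p

  InF-sym : ∀ {F a b} → InF p F a b → InF p F b a
  InF-sym = swap

  f-across-edge : ∀ c → InF p (f c) (c , one) (c , two)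
  f-across-edge c = inj₁ (inj₂ (refl , refl))

  f-chord : ∀ {c j} → 1 ≤ j → j ≤ (p ∸ 1) / 2 → ∀ s →
            InF p (f c) (c +ₚ [ j ]ₚ , s) (c -ₚ [ j ]ₚ , s)
  f-chord {j = j} 1≤j j≤ one = inj₁ (inj₁ (j , 1≤j , j≤ , inj₁ (refl , refl)))
  f-chord {j = j} 1≤j j≤ two = inj₁ (inj₁ (j , 1≤j , j≤ , inj₂ (refl , refl)))

  g-edge : ∀ {i} (i≢0 : i ≢ [ 0 ]ₚ) x → InF p (g i i≢0) (x , one) (i +ₚ x , two)
  g-edge i≢0 x = inj₁ (x , refl , refl)

  chord-sum : ∀ c d → c +ₚ d +ₚ (c -ₚ d) ≡ c +ₚ c
  chord-sum c d =
    ≡-byℤ (atom c :+ atom d :+ (atom c :- atom d)) (atom c :+ atom c) (identity (toℤ c) (toℤ d))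
    where
    identity : ∀ c d → c + d + (c - d) ≡ c + c
    identity = solve-∀

  private
    f′-same-side : ∀ {i x y s} → InF' p (f i) (x , s) (y , s) → x +ₚ y ≡ i +ₚ i
    f′-same-side (inj₁ (j , _ , _ , inj₁ (refl , refl))) = chord-sum _ [ j ]ₚ
    f′-same-side (inj₁ (j , _ , _ , inj₂ (refl , refl))) = chord-sum _ [ j ]ₚ
    f′-same-side (inj₂ (refl , ()))

  f-same-side : ∀ {i x y s} → InF p (f i) (x , s) (y , s) → x +ₚ y ≡ i +ₚ i
  f-same-side (inj₁ xy∈fᵢ)             = f′-same-side xy∈fᵢ
  f-same-side {x = x} {y} (inj₂ yx∈fᵢ) = trans (+ₚ-comm x y) (f′-same-side yx∈fᵢ)

  f-across : ∀ {i x y} → InF p (f i) (x , one) (y , two) → x ≡ i × y ≡ i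
  f-across (inj₁ (inj₁ (_ , _ , _ , inj₁ (_ , ()))))
  f-across (inj₁ (inj₁ (_ , _ , _ , inj₂ (() , _))))
  f-across (inj₁ (inj₂ (refl , refl))) = refl , refl
  f-across (inj₂ (inj₁ (_ , _ , _ , inj₁ (() , _))))
  f-across (inj₂ (inj₁ (_ , _ , _ , inj₂ (_ , ()))))
  f-across (inj₂ (inj₂ (() , _)))

  g-same-side : ∀ {i} (i≢0 : i ≢ [ 0 ]ₚ) {x y s} → ¬ InF p (g i i≢0) (x , s) (y , s)
  g-same-side _ (inj₁ (_ , refl , ()))
  g-same-side _ (inj₂ (_ , refl , ()))

  g-across : ∀ {i} (i≢0 : i ≢ [ 0 ]ₚ) {x y} → InF p (g i i≢0) (x , one) (y , two) → y ≡ i +ₚ x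
  g-across _ (inj₁ (_ , refl , refl)) = refl
  g-across _ (inj₂ (_ , () , _))

  LIs-diagonal : ∀ {v a} → a ≢ v → LIs p v a a a
  LIs-diagonal a≢v = a≢v , inj₁ (refl , refl) , λ where
    k _ (inj₁ (_ , k≡a))    → k≡a
    k _ (inj₂ (a≢a , _))    → ⊥-elim (a≢a refl)

  -- LRel does not presuppose that GA_{2p} is a 1-factorisation, so the last
  -- hypothesis ranges over every factor through ab, not only over F.
  LIs-intro : ∀ {v a b val} F → val ≢ v → a ≢ b → InF p F a b → InF p F val v →
              (∀ F k → k ≢ v → InF p F a b → InF p F k v → k ≡ val) → LIs p v a b val
  LIs-intro F val≢v a≢b ab∈F val∈F unique = val≢v , inj₂ (a≢b , F , ab∈F , val∈F) , λ where
    k _   (inj₁ (a≡b , _))             → ⊥-elim (a≢b a≡b)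
    k k≢v (inj₂ (_ , F′ , ab∈F′ , k∈F′)) → unique F′ k k≢v ab∈F′ k∈F′

  LIs-sym : ∀ {v a b val} → LIs p v a b val → LIs p v b a val
  LIs-sym (val≢v , entry , unique) = val≢v , flip entry , λ k k≢v → unique k k≢v ∘ flip
    where
    flip : ∀ {v a b k} → LRel p v a b k → LRel p v b a k
    flip (inj₁ (a≡b , k≡a))            = inj₁ (sym a≡b , trans k≡a a≡b)
    flip (inj₂ (a≢b , F , ab∈F , k∈F)) = inj₂ (a≢b ∘ sym , F , InF-sym ab∈F , k∈F)

module RootedSquare (p q : ℕ) .{{_ : NonZero p}} (p≡1+2q : p ≡ suc (2 ℕ.* q)) where

  open ZpArithmetic p
  open OddZp p q p≡1+2q
  open GA p

  f-contains : ∀ {a b c} → a ≢ b → c +ₚ c ≡ a +ₚ b → ∀ s → InF p (f c) (a , s) (b , s)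
  f-contains {a} {b} {c} a≢b 2c≡a+b s = from-representative (±-representative d≢0)
    where
    open ≡-Reasoning
    d = a -ₚ c

    a≡c+d : a ≡ c +ₚ d
    a≡c+d = ≡-byℤ (atom a) (atom c :+ (atom a :- atom c)) (identity (toℤ a) (toℤ c))
      where
      identity : ∀ a c → a ≡ c + (a - c)
      identity = solve-∀

    b≡c-d : b ≡ c -ₚ d
    b≡c-d = begin
      b                 ≡⟨ ≡-byℤ (atom b) (atom a :+ atom b :- atom a) (identity₁ (toℤ a) (toℤ b)) ⟩
      a +ₚ b -ₚ a       ≡⟨ cong (_-ₚ a) 2c≡a+b ⟨
      c +ₚ c -ₚ a       ≡⟨ ≡-byℤ (atom c :+ atom c :- atom a) (atom c :- (atom a :- atom c))
                                  (identity₂ (toℤ a) (toℤ c)) ⟩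
      c -ₚ d            ∎
      where
      identity₁ : ∀ a b → b ≡ a + b - a
      identity₁ = solve-∀
      identity₂ : ∀ a c → c + c - a ≡ c - (a - c)
      identity₂ = solve-∀

    d≢0 : d ≢ [ 0 ]ₚ
    d≢0 d≡0 = a≢b (begin
      a                 ≡⟨ a≡c+d ⟩
      c +ₚ d            ≡⟨ cong (c +ₚ_) d≡0 ⟩
      c +ₚ [ 0 ]ₚ       ≡⟨ ≡-byℤ (atom c :+ lit 0) (atom c :- lit 0) refl ⟩
      c -ₚ [ 0 ]ₚ       ≡⟨ cong (λ e → c -ₚ e) d≡0 ⟨
      c -ₚ d            ≡⟨ b≡c-d ⟨
      b                 ∎)

    a≡c-[-d] : a ≡ c -ₚ (-ₚ d)
    a≡c-[-d] = trans a≡c+d (≡-byℤ (atom c :+ atom d) (atom c :- :- atom d) (identity (toℤ c) (toℤ d)))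
      where
      identity : ∀ c d → c + d ≡ c - - d
      identity = solve-∀

    from-representative : Σ ℕ (λ j → 1 ≤ j × j ≤ (p ∸ 1) / 2 × (d ≡ [ j ]ₚ ⊎ -ₚ d ≡ [ j ]ₚ)) →
                          InF p (f c) (a , s) (b , s)
    from-representative (j , 1≤j , j≤ , inj₁ d≡j) =
      subst₂ (λ u w → InF p (f c) (u , s) (w , s))
             (sym (trans a≡c+d (cong (c +ₚ_) d≡j))) (sym (trans b≡c-d (cong (λ e → c -ₚ e) d≡j)))
             (f-chord 1≤j j≤ s)
    from-representative (j , 1≤j , j≤ , inj₂ -d≡j) = InF-sym
      (subst₂ (λ u w → InF p (f c) (u , s) (w , s))
              (sym (trans b≡c-d (cong (c +ₚ_) -d≡j))) (sym (trans a≡c-[-d] (cong (λ e → c -ₚ e) -d≡j)))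
              (f-chord 1≤j j≤ s))

  −1ₚ : Zp p
  −1ₚ = -ₚ [ 1 ]ₚ

  root : Vertex p
  root = −1ₚ , two

  private
    −1+−1+2≡0 : −1ₚ +ₚ −1ₚ +ₚ [ 2 ]ₚ ≡ [ 0 ]ₚ
    −1+−1+2≡0 = ≡-byℤ (:- lit 1 :+ :- lit 1 :+ lit 2) (lit 0) refl

    a−1≡b⇒a≡b+1 : ∀ {a b} → a +ₚ −1ₚ ≡ b → a ≡ b +ₚ [ 1 ]ₚ
    a−1≡b⇒a≡b+1 {b = b} a−1≡b = trans (a+b≡c⇒a≡c-b −1ₚ a−1≡b) (≡-byℤ (atom b :- :- lit 1) (atom b :+ lit 1) refl)

    a+1≡−1⇒a+2≡0 : ∀ {a} → a +ₚ [ 1 ]ₚ ≡ −1ₚ → a +ₚ [ 2 ]ₚ ≡ [ 0 ]ₚ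
    a+1≡−1⇒a+2≡0 {a} a+1≡−1 = begin
      a +ₚ [ 2 ]ₚ            ≡⟨ ≡-byℤ (atom a :+ lit 2) (atom a :+ lit 1 :+ lit 1) (identity (toℤ a)) ⟩
      a +ₚ [ 1 ]ₚ +ₚ [ 1 ]ₚ  ≡⟨ cong (_+ₚ [ 1 ]ₚ) a+1≡−1 ⟩
      −1ₚ +ₚ [ 1 ]ₚ          ≡⟨ ≡-byℤ (:- lit 1 :+ lit 1) (lit 0) refl ⟩
      [ 0 ]ₚ                 ∎
      where
      open ≡-Reasoning
      identity : ∀ a → a + + 2 ≡ a + + 1 + + 1
      identity = solve-∀

  same-side-entry : ∀ {x y} s → x ≢ y → x +ₚ y +ₚ [ 2 ]ₚ ≢ [ 0 ]ₚ →
                    LIs p root (x , s) (y , s) (x +ₚ y +ₚ [ 1 ]ₚ , two)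
  same-side-entry {x} {y} s x≢y S+2≢0 =
    LIs-intro (f (half S)) (S+1≢−1 ∘ cong proj₁) (x≢y ∘ cong proj₁)
      (f-contains x≢y (half-+ₚ-half S) s)
      (f-contains S+1≢−1 (trans (half-+ₚ-half S) (sym (a+b-b≡a S [ 1 ]ₚ))) two)
      unique
    where
    S = x +ₚ y
    S+1≢−1 : S +ₚ [ 1 ]ₚ ≢ −1ₚ
    S+1≢−1 = S+2≢0 ∘ a+1≡−1⇒a+2≡0
    unique : ∀ F k → k ≢ root → InF p F (x , s) (y , s) → InF p F k root → k ≡ (S +ₚ [ 1 ]ₚ , two)
    unique (f i) (k , one) _ xy∈fᵢ k∈fᵢ = ⊥-elim (S+2≢0 (begin
      S +ₚ [ 2 ]ₚ            ≡⟨ cong (_+ₚ [ 2 ]ₚ) (f-same-side xy∈fᵢ) ⟩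
      i +ₚ i +ₚ [ 2 ]ₚ       ≡⟨ cong (λ c → c +ₚ c +ₚ [ 2 ]ₚ) (proj₂ (f-across k∈fᵢ)) ⟨
      −1ₚ +ₚ −1ₚ +ₚ [ 2 ]ₚ   ≡⟨ −1+−1+2≡0 ⟩
      [ 0 ]ₚ                 ∎))
      where open ≡-Reasoning
    unique (f i) (k , two) _ xy∈fᵢ k∈fᵢ =
      cong (_, two) (a−1≡b⇒a≡b+1 (trans (f-same-side k∈fᵢ) (sym (f-same-side xy∈fᵢ))))
    unique (g i i≢0) _ _ xy∈gᵢ _ = ⊥-elim (g-same-side i≢0 xy∈gᵢ)

  same-side-entry-−2 : ∀ {x y} s → x ≢ y → x +ₚ y +ₚ [ 2 ]ₚ ≡ [ 0 ]ₚ →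
                       LIs p root (x , s) (y , s) (−1ₚ , one)
  same-side-entry-−2 {x} {y} s x≢y S+2≡0 =
    LIs-intro (f −1ₚ) (λ ()) (x≢y ∘ cong proj₁) (f-contains x≢y −1+−1≡S s) (f-across-edge −1ₚ) unique
    where
    −1+−1≡S : −1ₚ +ₚ −1ₚ ≡ x +ₚ y
    −1+−1≡S = +ₚ-cancelʳ [ 2 ]ₚ (trans −1+−1+2≡0 (sym S+2≡0))
    unique : ∀ F k → k ≢ root → InF p F (x , s) (y , s) → InF p F k root → k ≡ (−1ₚ , one)
    unique (f i) (k , one) _ _ k∈fᵢ =
      cong (_, one) (trans (proj₁ (f-across k∈fᵢ)) (sym (proj₂ (f-across k∈fᵢ))))
    unique (f i) (k , two) k≢root xy∈fᵢ k∈fᵢ = ⊥-elim (k≢root (cong (_, two)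
      (+ₚ-cancelʳ −1ₚ (trans (f-same-side k∈fᵢ) (trans (sym (f-same-side xy∈fᵢ)) (sym −1+−1≡S))))))
    unique (g i i≢0) _ _ xy∈gᵢ _ = ⊥-elim (g-same-side i≢0 xy∈gᵢ)

  vertical-entry : ∀ {x} → x ≢ −1ₚ → LIs p root (x , one) (x , two) (x +ₚ x +ₚ [ 1 ]ₚ , two)
  vertical-entry {x} x≢−1 =
    LIs-intro (f x) (2x+1≢−1 ∘ cong proj₁) (λ ()) (f-across-edge x)
      (f-contains 2x+1≢−1 (sym (a+b-b≡a (x +ₚ x) [ 1 ]ₚ)) two) unique
    where
    2x+1≢−1 : x +ₚ x +ₚ [ 1 ]ₚ ≢ −1ₚ
    2x+1≢−1 2x+1≡−1 = x≢−1 (+ₚ-double-injective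
      (trans (sym (a+b-b≡a (x +ₚ x) [ 1 ]ₚ)) (cong (_+ₚ −1ₚ) 2x+1≡−1)))
    unique : ∀ F k → k ≢ root → InF p F (x , one) (x , two) → InF p F k root →
             k ≡ (x +ₚ x +ₚ [ 1 ]ₚ , two)
    unique (f i) (k , one) _ xx∈fᵢ k∈fᵢ =
      ⊥-elim (x≢−1 (trans (proj₁ (f-across xx∈fᵢ)) (sym (proj₂ (f-across k∈fᵢ)))))
    unique (f i) (k , two) _ xx∈fᵢ k∈fᵢ = cong (_, two) (a−1≡b⇒a≡b+1
      (trans (f-same-side k∈fᵢ) (cong (λ c → c +ₚ c) (sym (proj₁ (f-across xx∈fᵢ))))))
    unique (g i i≢0) _ _ xx∈gᵢ _ =
      ⊥-elim (i≢0 (+ₚ-cancelʳ x (trans (sym (g-across i≢0 xx∈gᵢ)) (sym (+ₚ-identityˡ x)))))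

  crossing-entry : ∀ {x y} → x ≢ y → LIs p root (x , one) (y , two) (x -ₚ y -ₚ [ 1 ]ₚ , one)
  crossing-entry {x} {y} x≢y =
    LIs-intro (g δ δ≢0) (λ ()) (λ ())
      (subst (λ u → InF p (g δ δ≢0) (x , one) (u , two)) (sym y≡δ+x) (g-edge δ≢0 x))
      (subst (λ u → InF p (g δ δ≢0) (val , one) (u , two)) (sym −1≡δ+val) (g-edge δ≢0 val))
      unique
    where
    δ = y -ₚ x
    val = x -ₚ y -ₚ [ 1 ]ₚ
    y≡δ+x : y ≡ δ +ₚ x
    y≡δ+x = ≡-byℤ (atom y) (atom y :- atom x :+ atom x) (identity (toℤ x) (toℤ y))
      where
      identity : ∀ x y → y ≡ y - x + x
      identity = solve-∀
    δ≢0 : δ ≢ [ 0 ]ₚ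
    δ≢0 δ≡0 = x≢y (sym (trans y≡δ+x (trans (cong (_+ₚ x) δ≡0) (+ₚ-identityˡ x))))
    −1≡δ+val : −1ₚ ≡ δ +ₚ val
    −1≡δ+val = ≡-byℤ (:- lit 1) (atom y :- atom x :+ (atom x :- atom y :- lit 1)) (identity (toℤ x) (toℤ y))
      where
      identity : ∀ x y → - + 1 ≡ y - x + (x - y - + 1)
      identity = solve-∀
    unique : ∀ F k → k ≢ root → InF p F (x , one) (y , two) → InF p F k root → k ≡ (val , one)
    unique (f i) _ _ xy∈fᵢ _ = ⊥-elim (x≢y (trans (proj₁ (f-across xy∈fᵢ)) (sym (proj₂ (f-across xy∈fᵢ)))))
    unique (g i i≢0) (k , one) _ xy∈gᵢ k∈gᵢ = cong (_, one) (begin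
      k              ≡⟨ a+b≡c⇒a≡c-b i (trans (+ₚ-comm k i) (sym (g-across i≢0 k∈gᵢ))) ⟩
      −1ₚ -ₚ i       ≡⟨ cong (λ e → −1ₚ -ₚ e) (a+b≡c⇒a≡c-b x (sym (g-across i≢0 xy∈gᵢ))) ⟩
      −1ₚ -ₚ δ       ≡⟨ −1-δ≡val ⟩
      val            ∎)
      where
      open ≡-Reasoning
      identity : ∀ x y → - + 1 - (y - x) ≡ x - y - + 1
      identity = solve-∀
      −1-δ≡val : −1ₚ -ₚ δ ≡ val
      −1-δ≡val = ≡-byℤ (:- lit 1 :- (atom y :- atom x)) (atom x :- atom y :- lit 1)
                       (identity (toℤ x) (toℤ y))
    unique (g i i≢0) (k , two) _ _ k∈gᵢ = ⊥-elim (g-same-side i≢0 k∈gᵢ)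

odd-prime : ∀ {p} → Prime p → p ≢ 2 → ∃ λ q → p ≡ suc (2 ℕ.* q)
odd-prime {p} p-prime p≢2 with p % 2 | m≡m%n+[m/n]*n p 2 | m%n<n p 2
... | 0           | p≡[p/2]*2   | _ =
  ⊥-elim ([ (λ ()) , p≢2 ∘ sym ]′ (prime⇒irreducible p-prime (ℕ.divides (p / 2) p≡[p/2]*2)))
... | 1           | p≡1+[p/2]*2 | _ = p / 2 , trans p≡1+[p/2]*2 (cong suc (ℕ.*-comm (p / 2) 2))
... | suc (suc _) | _           | ℕ.s≤s (ℕ.s≤s ())

lemma5 : (p : ℕ) .{{_ : NonZero p}} → Prime p → p ≢ 2 →
    let v = ⊖_ p ([_] p 1) , two in
    (x y : Zp p) (z w : Side) → (x , z) ≢ v → (y , w) ≢ v →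
      ((x , z) ≡ (y , w) → LIs p v (x , z) (y , w) (x , z))
    × ((x , z) ≢ (y , w) → z ≡ w → _⊕_ p (_⊕_ p x y) ([_] p 2) ≢ [_] p 0 →
        LIs p v (x , z) (y , w) (_⊕_ p (_⊕_ p x y) ([_] p 1) , two))
    × ((x , z) ≢ (y , w) → z ≡ w → _⊕_ p (_⊕_ p x y) ([_] p 2) ≡ [_] p 0 →
        LIs p v (x , z) (y , w) (⊖_ p ([_] p 1) , one))
    × (z ≢ w → x ≡ y →
        LIs p v (x , z) (y , w) (_⊕_ p (_⊕_ p x x) ([_] p 1) , two))
    × (z ≡ one → w ≡ two → x ≢ y →
        LIs p v (x , z) (y , w) (_⊝_ p (_⊝_ p x y) ([_] p 1) , one))
    × (z ≡ two → w ≡ one → x ≢ y →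
        LIs p v (x , z) (y , w) (_⊝_ p (_⊝_ p y x) ([_] p 1) , one))
lemma5 p p-prime p≢2 x y z w xz≢root yw≢root =
    (λ { refl → LIs-diagonal xz≢root })
  , (λ { xz≢yw refl → same-side-entry z (xz≢yw ∘ cong (_, z)) })
  , (λ { xz≢yw refl → same-side-entry-−2 z (xz≢yw ∘ cong (_, z)) })
  , vertical z w xz≢root yw≢root
  , (λ { refl refl → crossing-entry })
  , (λ { refl refl x≢y → LIs-sym (crossing-entry (x≢y ∘ sym)) })
  where
  open ZpArithmetic p using (_+ₚ_; [_]ₚ)
  open GA p
  open RootedSquare p (proj₁ (odd-prime p-prime p≢2)) (proj₂ (odd-prime p-prime p≢2))
  vertical : ∀ z w → (x , z) ≢ root → (y , w) ≢ root → z ≢ w → x ≡ y →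
             LIs p root (x , z) (y , w) (x +ₚ x +ₚ [ 1 ]ₚ , two)
  vertical one one _       _       z≢w _    = ⊥-elim (z≢w refl)
  vertical one two _       y₂≢root _   refl = vertical-entry (y₂≢root ∘ cong (_, two))
  vertical two one x₂≢root _       _   refl = LIs-sym (vertical-entry (x₂≢root ∘ cong (_, two)))
  vertical two two _       _       z≢w _    = ⊥-elim (z≢w refl)
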